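{- For each integer $n\geq 1$ there is an orientably regular hypermap whose chirality group is cyclic of order $n$.
   Context: Let $\Delta=\langle r_0,r_1,r_2\mid r_0^2=r_1^2=r_2^2=1\rangle$ and let $\Delta^+$ be its index-$2$ subgroup of even-length words, generated by $\rho=r_1r_2$ and $\lambda=r_2r_0$. An (oriented) hypermap is a triple $\mathcal H=(D,R,L)$ where $D$ is a finite set and $R,L$ are permutations of $D$ such that the monodromy group $\mathrm{Mon}(\mathcal H)=\langle R,L\rangle$ acts transitively on $D$. It is orientably regular if its automorphism group (permutations of $D$ commuting with $R$ and $L$) acts regularly on $D$; every orientably regular hypermap is isomorphic to $(\Delta^+/H,\rho,\lambda)$, with $\rho,\lambda$ acting by left multiplication on cosets, for a unique normal subgroup $H$ of finite index in $\Delta^+$ (its hypermap subgroup), and every such $H$ arises. For $H\trianglelefteq\Delta^+$ put $H^r=r_2Hr_2$. The chirality group of $\mathcal H$ is $X(\mathcal H)=HH^r/H$ (isomorphic to $H/(H\cap H^r)$). -}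

module Defs where

open import Data.Nat using (ℕ; zero; suc; _<_)
open import Data.Fin using (Fin)
import Data.Fin as F
open import Data.Fin.Permutation using (Permutation′; _⟨$⟩ʳ_; _⟨$⟩ˡ_)
open import Data.List using (List; []; _∷_; _++_; map)
open import Data.Product using (Σ; _×_; _,_; ∃)
open import Relation.Binary.PropositionalEquality using (_≡_)

-- Letters of the free group Δ⁺ = ⟨ρ, λ⟩ (free of rank 2): ρ, ρ⁻¹, λ, λ⁻¹.
data Letter : Set where
  ρ ρ⁻ λ′ λ⁻ : Letter

-- Words in Δ⁺ (elements of Δ⁺ are words up to free reduction).
Word : Set
Word = List Letter

-- The automorphism w ↦ r₂ w r₂ of Δ⁺ : ρ = r₁r₂ ↦ r₂r₁ = ρ⁻¹, λ = r₂r₀ ↦ r₀r₂ = λ⁻¹.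
mirrorL : Letter → Letter
mirrorL ρ  = ρ⁻
mirrorL ρ⁻ = ρ
mirrorL λ′ = λ⁻
mirrorL λ⁻ = λ′

mirror : Word → Word
mirror = map mirrorL

_^ʷ_ : Word → ℕ → Word
w ^ʷ zero  = []
w ^ʷ suc i = w ++ (w ^ʷ i)

record Hypermap : Set where
  field
    m : ℕ
    R : Permutation′ (suc m)
    L : Permutation′ (suc m)

  Dart : Set
  Dart = Fin (suc m)

  actL : Letter → Dart → Dart
  actL ρ  d = R ⟨$⟩ʳ d
  actL ρ⁻ d = R ⟨$⟩ˡ d
  actL λ′ d = L ⟨$⟩ʳ d
  actL λ⁻ d = L ⟨$⟩ˡ d

  act : Word → Dart → Dart
  act []      d = d
  act (x ∷ w) d = actL x (act w d)

  -- elements of Mon(H) = ⟨R,L⟩, represented by words; equality pointwise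
  _≈ʷ_ : Word → Word → Set
  u ≈ʷ v = ∀ d → act u d ≡ act v d

  Transitive : Set
  Transitive = ∀ d e → ∃ λ w → act w d ≡ e

  IsAut : Permutation′ (suc m) → Set
  IsAut f = (∀ d → f ⟨$⟩ʳ (R ⟨$⟩ʳ d) ≡ R ⟨$⟩ʳ (f ⟨$⟩ʳ d))
          × (∀ d → f ⟨$⟩ʳ (L ⟨$⟩ʳ d) ≡ L ⟨$⟩ʳ (f ⟨$⟩ʳ d))

  OrientablyRegular : Set
  OrientablyRegular =
    ∀ d e → Σ (Permutation′ (suc m)) (λ f → IsAut f × f ⟨$⟩ʳ d ≡ e
            × (∀ g → IsAut g → g ⟨$⟩ʳ d ≡ e → ∀ x → g ⟨$⟩ʳ x ≡ f ⟨$⟩ʳ x))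

  -- hypermap subgroup H ⊴ Δ⁺: stabiliser of the dart 0 (for a regular hypermap
  -- this is the normal subgroup H with H ≅ (Δ⁺/H, ρ, λ))
  InH : Word → Set
  InH w = act w F.zero ≡ F.zero

  -- chirality group X = HH^r/H, viewed inside Δ⁺/H ≅ Mon(H):
  -- the image of H^r = r₂Hr₂ = mirror(H) in Mon(H).
  InX : Word → Set
  InX u = ∃ λ w → InH w × u ≈ʷ mirror w

  ChiralityCyclicOfOrder : ℕ → Set
  ChiralityCyclicOfOrder n =
    Σ Word λ g → InX g
      × (∀ u → InX u → Σ ℕ λ i → i < n × u ≈ʷ (g ^ʷ i))
      × (∀ i j → i < n → j < n → (g ^ʷ i) ≈ʷ (g ^ʷ j) → i ≡ j)

-- Let n ≥ 1, s = n(n+2), K = ns, r = n+1 and M = 2n, so that r² = 1 + s and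
-- r^M = (1+s)^n ≡ 1 + ns ≡ 1 (mod K).  The semidirect product G = ℤ_K ⋊_r ℤ_M is generated
-- by ρ = (0,1) and λ = (1,0), with ρλρ⁻¹ = λʳ; its Cayley hypermap (R and L multiply on the
-- left by ρ and λ) is orientably regular, the automorphisms being the right multiplications.
-- Since r² ≡ 1 (mod s), (c, j) ↦ (−c, −j) is an automorphism of the quotient
-- G/⟨λˢ⟩ ≅ ℤ_s ⋊_r ℤ_M inverting both generators, so the mirror image of every relator lies
-- in ⟨λˢ⟩, which is cyclic of order n.  Conversely the relator ρ⁻¹λ⁻ʳρλ has mirror image
-- ρλʳρ⁻¹λ⁻¹ = λ^(r²−1) = λˢ, so the chirality group is all of ⟨λˢ⟩.

module Submission where

open import Defs
open import Data.Nat using (ℕ; _≥_)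
open import Data.Product using (Σ; _×_)
open Hypermap

open import Data.Nat using (zero; suc; _+_; _*_; _^_; _<_; NonZero; _%_; _/_; pred)
open import Data.Nat.Properties
open import Data.Nat.DivMod hiding (_mod_)
import Data.Nat.DivMod as ℕ using (_mod_)
open import Data.Nat.Divisibility using (_∣_; divides)
open import Algebra.Properties.CommutativeSemigroup +-commutativeSemigroup using (interchange)
open import Data.Fin as Fin using (Fin; toℕ)
open import Data.Fin.Properties using (toℕ-fromℕ<; toℕ-injective; toℕ<n; *↔×)
open import Data.Fin.Permutation using (Permutation′; _⟨$⟩ʳ_; _⟨$⟩ˡ_; inverseˡ; inverseʳ)
open import Data.List using ([]; _∷_; _++_)
open import Data.List.Properties using (map-++)
open import Data.Product using (_,_; ∃; proj₁; proj₂)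
open import Algebra.Core using (Op₁; Op₂)
open import Algebra.Bundles using (Group)
open import Algebra.Structures using (IsGroup)
import Algebra.Properties.Group as GroupProperties
open import Function.Base using (_∘_)
open import Function.Bundles using (Inverse; _↔_; mk↔ₛ′)
open import Function.Properties.Inverse using (↔-sym; ↔-trans)
open import Level using (0ℓ)
open import Relation.Binary.Bundles using (Setoid)
open import Relation.Binary.Structures using (IsEquivalence)
open import Relation.Binary.PropositionalEquality
import Relation.Binary.Reasoning.Setoid as SetoidReasoning
open import Data.Nat.Tactic.RingSolver using (solve-∀)

infix 4 _≡_mod_
record _≡_mod_ (a b d : ℕ) .{{_ : NonZero d}} : Set where
  constructor mod≡
  field %-≡ : a % d ≡ b % d
open _≡_mod_ public

module _ {d : ℕ} .{{_ : NonZero d}} where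

  0%d≡0 : 0 % d ≡ 0
  0%d≡0 = m*n%n≡0 0 d

  ≡mod-isEquivalence : IsEquivalence (λ a b → a ≡ b mod d)
  ≡mod-isEquivalence = record
    { refl  = mod≡ refl
    ; sym   = λ (mod≡ p) → mod≡ (sym p)
    ; trans = λ (mod≡ p) (mod≡ q) → mod≡ (trans p q)
    }

  ≡mod-refl : ∀ {a} → a ≡ a mod d
  ≡mod-refl = IsEquivalence.refl ≡mod-isEquivalence

  ≡mod-sym : ∀ {a b} → a ≡ b mod d → b ≡ a mod d
  ≡mod-sym = IsEquivalence.sym ≡mod-isEquivalence

  ≡mod-trans : ∀ {a b c} → a ≡ b mod d → b ≡ c mod d → a ≡ c mod d
  ≡mod-trans = IsEquivalence.trans ≡mod-isEquivalence

  ≡⇒≡mod : ∀ {a b} → a ≡ b → a ≡ b mod d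
  ≡⇒≡mod p = mod≡ (cong (_% d) p)

  %-≡mod : ∀ a → a % d ≡ a mod d
  %-≡mod a = mod≡ (m%n%n≡m%n a d)

  d≡0-mod : d ≡ 0 mod d
  d≡0-mod = mod≡ (trans (n%n≡0 d) (sym 0%d≡0))

  d*m≡0-mod : ∀ m → d * m ≡ 0 mod d
  d*m≡0-mod m = mod≡ (trans (cong (_% d) (*-comm d m)) (trans (m*n%n≡0 m d) (sym 0%d≡0)))

  +-cong-mod : ∀ {a b c e} → a ≡ b mod d → c ≡ e mod d → a + c ≡ b + e mod d
  +-cong-mod {a} {b} {c} {e} (mod≡ p) (mod≡ q) = mod≡ (begin
    (a + c) % d             ≡⟨ %-distribˡ-+ a c d ⟩
    (a % d + c % d) % d     ≡⟨ cong₂ (λ x y → (x + y) % d) p q ⟩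
    (b % d + e % d) % d     ≡⟨ %-distribˡ-+ b e d ⟨
    (b + e) % d             ∎)
    where open ≡-Reasoning

  *-cong-mod : ∀ {a b c e} → a ≡ b mod d → c ≡ e mod d → a * c ≡ b * e mod d
  *-cong-mod {a} {b} {c} {e} (mod≡ p) (mod≡ q) = mod≡ (begin
    (a * c) % d             ≡⟨ %-distribˡ-* a c d ⟩
    (a % d * (c % d)) % d   ≡⟨ cong₂ (λ x y → (x * y) % d) p q ⟩
    (b % d * (e % d)) % d   ≡⟨ %-distribˡ-* b e d ⟨
    (b * e) % d             ∎)
    where open ≡-Reasoning

  +-congˡ-mod : ∀ a {b c} → b ≡ c mod d → a + b ≡ a + c mod d
  +-congˡ-mod a = +-cong-mod (≡mod-refl {a = a})

  *-congˡ-mod : ∀ a {b c} → b ≡ c mod d → a * b ≡ a * c mod d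
  *-congˡ-mod a = *-cong-mod (≡mod-refl {a = a})

  *-congʳ-mod : ∀ a {b c} → b ≡ c mod d → b * a ≡ c * a mod d
  *-congʳ-mod a p = *-cong-mod p (≡mod-refl {a = a})

  ^-congˡ-mod : ∀ {a b} → a ≡ b mod d → ∀ k → a ^ k ≡ b ^ k mod d
  ^-congˡ-mod p zero    = mod≡ refl
  ^-congˡ-mod p (suc k) = *-cong-mod p (^-congˡ-mod p k)

  toℕ-mod : ∀ a → toℕ (a ℕ.mod d) ≡ a mod d
  toℕ-mod a = mod≡ (trans (cong (_% d) (toℕ-fromℕ< (m%n<n a d))) (m%n%n≡m%n a d))

  mod-cong : ∀ {a b} → a ≡ b mod d → a ℕ.mod d ≡ b ℕ.mod d
  mod-cong (mod≡ p) = toℕ-injective (trans (toℕ-fromℕ< _) (trans p (sym (toℕ-fromℕ< _))))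

  mod-injective : ∀ {a b} → a ℕ.mod d ≡ b ℕ.mod d → a ≡ b mod d
  mod-injective p = mod≡ (trans (sym (toℕ-fromℕ< _)) (trans (cong toℕ p) (toℕ-fromℕ< _)))

  toℕ-mod-toℕ : ∀ (i : Fin d) → toℕ i ℕ.mod d ≡ i
  toℕ-mod-toℕ i = toℕ-injective (trans (toℕ-fromℕ< _) (m<n⇒m%n≡m (toℕ<n i)))

  ≡mod⇒≡ : ∀ {a b} → a < d → b < d → a ≡ b mod d → a ≡ b
  ≡mod⇒≡ a<d b<d (mod≡ p) = trans (sym (m<n⇒m%n≡m a<d)) (trans p (m<n⇒m%n≡m b<d))

  +-cancelˡ-≡0-mod : ∀ {a b} → a ≡ 0 mod d → a + b ≡ 0 mod d → b ≡ 0 mod d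
  +-cancelˡ-≡0-mod {a} {b} a≡0 a+b≡0 = ≡mod-trans (+-cong-mod (≡mod-sym a≡0) (≡mod-refl {a = b})) a+b≡0

≡mod-setoid : (d : ℕ) .{{_ : NonZero d}} → Setoid 0ℓ 0ℓ
≡mod-setoid d = record { isEquivalence = ≡mod-isEquivalence {d} }

module ≡mod-Reasoning (d : ℕ) .{{_ : NonZero d}} = SetoidReasoning (≡mod-setoid d)

≡mod-weaken : ∀ {a b d e} .{{_ : NonZero d}} .{{_ : NonZero e}} → d ∣ e → a ≡ b mod e → a ≡ b mod d
≡mod-weaken {a} {b} {d} {e} d∣e (mod≡ p) =
  mod≡ (trans (sym (m∣n⇒o%n%m≡o%m d e a d∣e)) (trans (cong (_% d) p) (m∣n⇒o%n%m≡o%m d e b d∣e)))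

commutes-with-inverse : ∀ {n} (σ : Permutation′ n) (f : Fin n → Fin n) →
  (∀ d → f (σ ⟨$⟩ʳ d) ≡ σ ⟨$⟩ʳ f d) → ∀ d → f (σ ⟨$⟩ˡ d) ≡ σ ⟨$⟩ˡ f d
commutes-with-inverse σ f comm d = begin
  f (σ ⟨$⟩ˡ d)                      ≡⟨ inverseˡ σ ⟨
  σ ⟨$⟩ˡ (σ ⟨$⟩ʳ f (σ ⟨$⟩ˡ d))      ≡⟨ cong (σ ⟨$⟩ˡ_) (comm (σ ⟨$⟩ˡ d)) ⟨
  σ ⟨$⟩ˡ f (σ ⟨$⟩ʳ (σ ⟨$⟩ˡ d))      ≡⟨ cong (λ e → σ ⟨$⟩ˡ f e) (inverseʳ σ) ⟩
  σ ⟨$⟩ˡ f d                        ∎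
  where open ≡-Reasoning

module _ (𝓗 : Hypermap) where

  IsAut⇒act-commutes : ∀ {f} → IsAut 𝓗 f → ∀ w d → f ⟨$⟩ʳ act 𝓗 w d ≡ act 𝓗 w (f ⟨$⟩ʳ d)
  IsAut⇒act-commutes                  _   []      d = refl
  IsAut⇒act-commutes {f} aut@(f∘R , f∘L) (x ∷ w) d =
    trans (actL-commutes x (act 𝓗 w d)) (cong (actL 𝓗 x) (IsAut⇒act-commutes {f} aut w d))
    where
      actL-commutes : ∀ x e → f ⟨$⟩ʳ actL 𝓗 x e ≡ actL 𝓗 x (f ⟨$⟩ʳ e)
      actL-commutes ρ  = f∘R
      actL-commutes ρ⁻ = commutes-with-inverse (R 𝓗) (f ⟨$⟩ʳ_) f∘R
      actL-commutes λ′ = f∘L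
      actL-commutes λ⁻ = commutes-with-inverse (L 𝓗) (f ⟨$⟩ʳ_) f∘L

  aut-determined-by-dart : Transitive 𝓗 → ∀ {f g} → IsAut 𝓗 f → IsAut 𝓗 g →
                           ∀ d → f ⟨$⟩ʳ d ≡ g ⟨$⟩ʳ d → ∀ e → f ⟨$⟩ʳ e ≡ g ⟨$⟩ʳ e
  aut-determined-by-dart transitive {f} {g} autf autg d fd≡gd e with transitive d e
  ... | w , refl = begin
    f ⟨$⟩ʳ act 𝓗 w d      ≡⟨ IsAut⇒act-commutes {f} autf w d ⟩
    act 𝓗 w (f ⟨$⟩ʳ d)    ≡⟨ cong (act 𝓗 w) fd≡gd ⟩
    act 𝓗 w (g ⟨$⟩ʳ d)    ≡⟨ IsAut⇒act-commutes {g} autg w d ⟨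
    g ⟨$⟩ʳ act 𝓗 w d      ∎
    where open ≡-Reasoning

-- Cayley hypermaps of two-generated groups

mirror-^ʷ : ∀ w t → mirror (w ^ʷ t) ≡ mirror w ^ʷ t
mirror-^ʷ w zero    = refl
mirror-^ʷ w (suc t) = trans (map-++ mirrorL w (w ^ʷ t)) (cong (mirror w ++_) (mirror-^ʷ w t))

module Cayley {P : Set} {_∙_ : Op₂ P} {ε : P} {_⁻¹ : Op₁ P}
              (isGroup : IsGroup _≡_ _∙_ ε _⁻¹) (a b : P) where

  open IsGroup isGroup using (assoc; identityˡ; identityʳ; _\\_; _//_)

  group : Group 0ℓ 0ℓ
  group = record { isGroup = isGroup }

  open GroupProperties group
    using (\\-leftDividesˡ; \\-leftDividesʳ; //-rightDividesˡ; //-rightDividesʳ)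

  gen : Letter → P
  gen ρ  = a
  gen ρ⁻ = a ⁻¹
  gen λ′ = b
  gen λ⁻ = b ⁻¹

  eval : Word → P
  eval []      = ε
  eval (x ∷ w) = gen x ∙ eval w

  eval-++ : ∀ u v → eval (u ++ v) ≡ eval u ∙ eval v
  eval-++ []      v = sym (identityˡ (eval v))
  eval-++ (x ∷ u) v = trans (cong (gen x ∙_) (eval-++ u v)) (sym (assoc (gen x) (eval u) (eval v)))

  Generates : Set
  Generates = ∀ g → ∃ λ w → eval w ≡ g

  leftMul rightMul : P → P ↔ P
  leftMul  g = mk↔ₛ′ (g ∙_) (g \\_) (\\-leftDividesˡ g) (\\-leftDividesʳ g)
  rightMul g = mk↔ₛ′ (_∙ g) (_// g) (//-rightDividesˡ g) (//-rightDividesʳ g)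

  module _ {m : ℕ} (enumeration : P ↔ Fin (suc m)) where
    open Inverse enumeration using (to; from; strictlyInverseˡ; strictlyInverseʳ)

    onDarts : P ↔ P → Permutation′ (suc m)
    onDarts σ = ↔-trans (↔-sym enumeration) (↔-trans σ enumeration)

    cayley : Hypermap
    cayley = record { m = m ; R = onDarts (leftMul a) ; L = onDarts (leftMul b) }

    to-injective : ∀ {g h} → to g ≡ to h → g ≡ h
    to-injective {g} {h} eq = trans (sym (strictlyInverseʳ g)) (trans (cong from eq) (strictlyInverseʳ h))

    actL-cayley : ∀ x d → actL cayley x d ≡ to (gen x ∙ from d)
    actL-cayley ρ  d = refl
    actL-cayley ρ⁻ d = refl
    actL-cayley λ′ d = refl
    actL-cayley λ⁻ d = refl

    act-cayley : ∀ w d → act cayley w d ≡ to (eval w ∙ from d)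
    act-cayley []      d = sym (trans (cong to (identityˡ (from d))) (strictlyInverseˡ d))
    act-cayley (x ∷ w) d = begin
      actL cayley x (act cayley w d)             ≡⟨ actL-cayley x (act cayley w d) ⟩
      to (gen x ∙ from (act cayley w d))         ≡⟨ cong (λ e → to (gen x ∙ from e)) (act-cayley w d) ⟩
      to (gen x ∙ from (to (eval w ∙ from d)))   ≡⟨ cong (λ g → to (gen x ∙ g)) (strictlyInverseʳ _) ⟩
      to (gen x ∙ (eval w ∙ from d))             ≡⟨ cong to (assoc (gen x) (eval w) (from d)) ⟨
      to (eval (x ∷ w) ∙ from d)                 ∎
      where open ≡-Reasoning

    transitive : Generates → Transitive cayley
    transitive generates d e with generates (from e // from d)
    ... | w , eval-w≡ = w , (begin
      act cayley w d                      ≡⟨ act-cayley w d ⟩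
      to (eval w ∙ from d)                ≡⟨ cong (λ g → to (g ∙ from d)) eval-w≡ ⟩
      to ((from e // from d) ∙ from d)    ≡⟨ cong to (//-rightDividesˡ (from d) (from e)) ⟩
      to (from e)                         ≡⟨ strictlyInverseˡ e ⟩
      e                                   ∎)
      where open ≡-Reasoning

    leftMul-commutes-rightMul : ∀ g h d →
      onDarts (rightMul h) ⟨$⟩ʳ (onDarts (leftMul g) ⟨$⟩ʳ d) ≡ onDarts (leftMul g) ⟨$⟩ʳ (onDarts (rightMul h) ⟨$⟩ʳ d)
    leftMul-commutes-rightMul g h d = begin
      to (from (to (g ∙ from d)) ∙ h)   ≡⟨ cong (λ x → to (x ∙ h)) (strictlyInverseʳ _) ⟩
      to ((g ∙ from d) ∙ h)             ≡⟨ cong to (assoc g (from d) h) ⟩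
      to (g ∙ (from d ∙ h))             ≡⟨ cong (λ x → to (g ∙ x)) (strictlyInverseʳ _) ⟨
      to (g ∙ from (to (from d ∙ h)))   ∎
      where open ≡-Reasoning

    rightMul-isAut : ∀ h → IsAut cayley (onDarts (rightMul h))
    rightMul-isAut h = leftMul-commutes-rightMul a h , leftMul-commutes-rightMul b h

    orientablyRegular : Generates → OrientablyRegular cayley
    orientablyRegular generates d e = onDarts (rightMul t) , rightMul-isAut t , d↦e , unique
      where
        t = from d \\ from e
        d↦e : to (from d ∙ t) ≡ e
        d↦e = trans (cong to (\\-leftDividesˡ (from d) (from e))) (strictlyInverseˡ e)
        unique : ∀ f → IsAut cayley f → f ⟨$⟩ʳ d ≡ e → ∀ x → f ⟨$⟩ʳ x ≡ onDarts (rightMul t) ⟨$⟩ʳ x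
        unique f autf fd≡e =
          aut-determined-by-dart cayley (transitive generates) {f} {onDarts (rightMul t)}
                                 autf (rightMul-isAut t) d (trans fd≡e (sym d↦e))

    act-at-ε : ∀ w → act cayley w (to ε) ≡ to (eval w)
    act-at-ε w = begin
      act cayley w (to ε)         ≡⟨ act-cayley w (to ε) ⟩
      to (eval w ∙ from (to ε))   ≡⟨ cong (λ g → to (eval w ∙ g)) (strictlyInverseʳ ε) ⟩
      to (eval w ∙ ε)             ≡⟨ cong to (identityʳ (eval w)) ⟩
      to (eval w)                 ∎
      where open ≡-Reasoning

    ≈ʷ⇒eval≡ : ∀ u v → _≈ʷ_ cayley u v → eval u ≡ eval v
    ≈ʷ⇒eval≡ u v u≈v = to-injective (trans (sym (act-at-ε u)) (trans (u≈v (to ε)) (act-at-ε v)))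

    eval≡⇒≈ʷ : ∀ u v → eval u ≡ eval v → _≈ʷ_ cayley u v
    eval≡⇒≈ʷ u v eq d = trans (act-cayley u d) (trans (cong (λ g → to (g ∙ from d)) eq) (sym (act-cayley v d)))

    module _ (to-ε : to ε ≡ Fin.zero) where

      InH⇒eval≡ε : ∀ w → InH cayley w → eval w ≡ ε
      InH⇒eval≡ε w w∈H = to-injective (begin
        to (eval w)             ≡⟨ act-at-ε w ⟨
        act cayley w (to ε)     ≡⟨ cong (act cayley w) to-ε ⟩
        act cayley w Fin.zero   ≡⟨ w∈H ⟩
        Fin.zero                ≡⟨ to-ε ⟨
        to ε                    ∎)
        where open ≡-Reasoning

      eval≡ε⇒InH : ∀ w → eval w ≡ ε → InH cayley w
      eval≡ε⇒InH w eval-w≡ε = begin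
        act cayley w Fin.zero   ≡⟨ cong (act cayley w) to-ε ⟨
        act cayley w (to ε)     ≡⟨ act-at-ε w ⟩
        to (eval w)             ≡⟨ cong to eval-w≡ε ⟩
        to ε                    ≡⟨ to-ε ⟩
        Fin.zero                ∎
        where open ≡-Reasoning

      chirality-cyclic : ∀ n w₀ → eval w₀ ≡ ε →
        (∀ w → eval w ≡ ε → ∃ λ i → i < n × eval (mirror w) ≡ eval (mirror w₀ ^ʷ i)) →
        (∀ i j → i < n → j < n → eval (mirror w₀ ^ʷ i) ≡ eval (mirror w₀ ^ʷ j) → i ≡ j) →
        ChiralityCyclicOfOrder cayley n
      chirality-cyclic n w₀ w₀∈H covered distinct =
        mirror w₀ , (w₀ , eval≡ε⇒InH w₀ w₀∈H , λ _ → refl) , cyclic ,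
        λ i j i<n j<n → distinct i j i<n j<n ∘ ≈ʷ⇒eval≡ (mirror w₀ ^ʷ i) (mirror w₀ ^ʷ j)
        where
          cyclic : ∀ u → InX cayley u → ∃ λ i → i < n × _≈ʷ_ cayley u (mirror w₀ ^ʷ i)
          cyclic u (w , w∈H , u≈mirror-w) with covered w (InH⇒eval≡ε w w∈H)
          ... | i , i<n , eq = i , i<n , λ d → trans (u≈mirror-w d) (eval≡⇒≈ʷ (mirror w) (mirror w₀ ^ʷ i) eq d)

-- The semidirect product ℤ_K ⋊_r ℤ_M

module Semidirect (K-1 M-1 r : ℕ) (r^M≡1 : r ^ suc M-1 ≡ 1 mod suc K-1) where

  K M : ℕ
  K = suc K-1
  M = suc M-1

  -- (c , j) represents λᶜρʲ, and ρʲλᶜ′ = λ^(rʲc′)ρʲ.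
  infixl 7 _·_
  _·_ : ℕ × ℕ → ℕ × ℕ → ℕ × ℕ
  (c , j) · (c′ , j′) = c + r ^ j * c′ , j + j′

  ·-assoc : ∀ x y z → (x · y) · z ≡ x · (y · z)
  ·-assoc (c , j) (c′ , j′) (c″ , j″) = cong₂ _,_ (begin
    c + r ^ j * c′ + r ^ (j + j′) * c″            ≡⟨ cong (λ e → c + r ^ j * c′ + e * c″) (^-distribˡ-+-* r j j′) ⟩
    c + r ^ j * c′ + r ^ j * r ^ j′ * c″          ≡⟨ +-assoc c (r ^ j * c′) _ ⟩
    c + (r ^ j * c′ + r ^ j * r ^ j′ * c″)        ≡⟨ cong (λ e → c + (r ^ j * c′ + e)) (*-assoc (r ^ j) (r ^ j′) c″) ⟩
    c + (r ^ j * c′ + r ^ j * (r ^ j′ * c″))      ≡⟨ cong (c +_) (*-distribˡ-+ (r ^ j) c′ (r ^ j′ * c″)) ⟨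
    c + r ^ j * (c′ + r ^ j′ * c″)                ∎)
    (+-assoc j j′ j″)
    where open ≡-Reasoning

  ·-identityˡ : ∀ x → (0 , 0) · x ≡ x
  ·-identityˡ (c , j) = cong (_, j) (*-identityˡ c)

  ·-identityʳ : ∀ x → x · (0 , 0) ≡ x
  ·-identityʳ (c , j) = cong₂ _,_ (trans (cong (c +_) (*-zeroʳ (r ^ j))) (+-identityʳ c)) (+-identityʳ j)

  r^-reduce : ∀ j → r ^ j ≡ r ^ (j % M) mod K
  r^-reduce j = begin
    r ^ j                                 ≡⟨ cong (r ^_) (m≡m%n+[m/n]*n j M) ⟩
    r ^ (j % M + j / M * M)               ≡⟨ ^-distribˡ-+-* r (j % M) (j / M * M) ⟩
    r ^ (j % M) * r ^ (j / M * M)         ≡⟨ cong (λ e → r ^ (j % M) * r ^ e) (*-comm (j / M) M) ⟩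
    r ^ (j % M) * r ^ (M * (j / M))       ≡⟨ cong (r ^ (j % M) *_) (^-*-assoc r M (j / M)) ⟨
    r ^ (j % M) * (r ^ M) ^ (j / M)       ≈⟨ *-congˡ-mod (r ^ (j % M)) (^-congˡ-mod r^M≡1 (j / M)) ⟩
    r ^ (j % M) * 1 ^ (j / M)             ≡⟨ cong (r ^ (j % M) *_) (^-zeroˡ (j / M)) ⟩
    r ^ (j % M) * 1                       ≡⟨ *-identityʳ (r ^ (j % M)) ⟩
    r ^ (j % M)                           ∎
    where open ≡mod-Reasoning K

  r^-cong : ∀ {j j′} → j ≡ j′ mod M → r ^ j ≡ r ^ j′ mod K
  r^-cong {j} {j′} (mod≡ j≡j′) = begin
    r ^ j             ≈⟨ r^-reduce j ⟩
    r ^ (j % M)       ≡⟨ cong (r ^_) j≡j′ ⟩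
    r ^ (j′ % M)      ≈⟨ r^-reduce j′ ⟨
    r ^ j′            ∎
    where open ≡mod-Reasoning K

  G : Set
  G = Fin K × Fin M

  ⟦_⟧ : ℕ × ℕ → G
  ⟦ c , j ⟧ = c ℕ.mod K , j ℕ.mod M

  ι : G → ℕ × ℕ
  ι (c , j) = toℕ c , toℕ j

  ⟦ι⟧ : ∀ g → ⟦ ι g ⟧ ≡ g
  ⟦ι⟧ (c , j) = cong₂ _,_ (toℕ-mod-toℕ c) (toℕ-mod-toℕ j)

  ⟦⟧-cong : ∀ {c c′ j j′} → c ≡ c′ mod K → j ≡ j′ mod M → ⟦ c , j ⟧ ≡ ⟦ c′ , j′ ⟧
  ⟦⟧-cong c≡c′ j≡j′ = cong₂ _,_ (mod-cong c≡c′) (mod-cong j≡j′)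

  ⟦⟧-injective : ∀ x y → ⟦ x ⟧ ≡ ⟦ y ⟧ → proj₁ x ≡ proj₁ y mod K × proj₂ x ≡ proj₂ y mod M
  ⟦⟧-injective _ _ eq = mod-injective (cong proj₁ eq) , mod-injective (cong proj₂ eq)

  infixl 7 _∙_
  _∙_ : G → G → G
  g ∙ h = ⟦ ι g · ι h ⟧

  ε : G
  ε = ⟦ 0 , 0 ⟧

  -- K-1 * x and M-1 * j stand for −x and −j.
  inv : ℕ × ℕ → ℕ × ℕ
  inv (c , j) = K-1 * (r ^ (M-1 * j) * c) , M-1 * j

  _⁻¹ : G → G
  g ⁻¹ = ⟦ inv (ι g) ⟧

  ⟦⟧-· : ∀ x y → ⟦ x ⟧ ∙ ⟦ y ⟧ ≡ ⟦ x · y ⟧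
  ⟦⟧-· (c , j) (c′ , j′) =
    ⟦⟧-cong (+-cong-mod (toℕ-mod c) (*-cong-mod (r^-cong (toℕ-mod j)) (toℕ-mod c′)))
            (+-cong-mod (toℕ-mod j) (toℕ-mod j′))

  ∙-assoc : ∀ g h k → (g ∙ h) ∙ k ≡ g ∙ (h ∙ k)
  ∙-assoc g h k = begin
    ⟦ ι g · ι h ⟧ ∙ k             ≡⟨ cong (⟦ ι g · ι h ⟧ ∙_) (⟦ι⟧ k) ⟨
    ⟦ ι g · ι h ⟧ ∙ ⟦ ι k ⟧       ≡⟨ ⟦⟧-· (ι g · ι h) (ι k) ⟩
    ⟦ ι g · ι h · ι k ⟧           ≡⟨ cong ⟦_⟧ (·-assoc (ι g) (ι h) (ι k)) ⟩
    ⟦ ι g · (ι h · ι k) ⟧         ≡⟨ ⟦⟧-· (ι g) (ι h · ι k) ⟨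
    ⟦ ι g ⟧ ∙ ⟦ ι h · ι k ⟧       ≡⟨ cong (_∙ (h ∙ k)) (⟦ι⟧ g) ⟩
    g ∙ (h ∙ k)                   ∎
    where open ≡-Reasoning

  ∙-identityˡ : ∀ g → ε ∙ g ≡ g
  ∙-identityˡ g = begin
    ε ∙ g                 ≡⟨ cong (ε ∙_) (⟦ι⟧ g) ⟨
    ε ∙ ⟦ ι g ⟧           ≡⟨ ⟦⟧-· (0 , 0) (ι g) ⟩
    ⟦ (0 , 0) · ι g ⟧     ≡⟨ cong ⟦_⟧ (·-identityˡ (ι g)) ⟩
    ⟦ ι g ⟧               ≡⟨ ⟦ι⟧ g ⟩
    g                     ∎
    where open ≡-Reasoning

  ∙-identityʳ : ∀ g → g ∙ ε ≡ g
  ∙-identityʳ g = begin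
    g ∙ ε                 ≡⟨ cong (_∙ ε) (⟦ι⟧ g) ⟨
    ⟦ ι g ⟧ ∙ ε           ≡⟨ ⟦⟧-· (ι g) (0 , 0) ⟩
    ⟦ ι g · (0 , 0) ⟧     ≡⟨ cong ⟦_⟧ (·-identityʳ (ι g)) ⟩
    ⟦ ι g ⟧               ≡⟨ ⟦ι⟧ g ⟩
    g                     ∎
    where open ≡-Reasoning

  inv-·ˡ : ∀ x → ⟦ inv x · x ⟧ ≡ ε
  inv-·ˡ (c , j) = ⟦⟧-cong
    (subst (_≡ 0 mod K) (+-comm (r ^ (M-1 * j) * c) _) (d*m≡0-mod (r ^ (M-1 * j) * c)))
    (subst (_≡ 0 mod M) (+-comm j (M-1 * j)) (d*m≡0-mod j))

  inv-·ʳ : ∀ x → ⟦ x · inv x ⟧ ≡ ε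
  inv-·ʳ (c , j) = ⟦⟧-cong (begin
    c + r ^ j * (K-1 * (r ^ (M-1 * j) * c))     ≡⟨ cong (c +_) (rearrange (r ^ j) (r ^ (M-1 * j)) K-1 c) ⟩
    c + K-1 * (r ^ j * r ^ (M-1 * j) * c)       ≡⟨ cong (λ e → c + K-1 * (e * c)) (^-distribˡ-+-* r j (M-1 * j)) ⟨
    c + K-1 * (r ^ (M * j) * c)                 ≈⟨ +-congˡ-mod c (*-congˡ-mod K-1 (*-congʳ-mod c (r^-cong (d*m≡0-mod j)))) ⟩
    c + K-1 * (1 * c)                           ≡⟨ cong (λ e → c + K-1 * e) (*-identityˡ c) ⟩
    K * c                                       ≈⟨ d*m≡0-mod c ⟩
    0                                           ∎)
    (d*m≡0-mod j)
    where
      open ≡mod-Reasoning K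
      rearrange : ∀ a b k c → a * (k * (b * c)) ≡ k * (a * b * c)
      rearrange = solve-∀

  ∙-inverseˡ : ∀ g → g ⁻¹ ∙ g ≡ ε
  ∙-inverseˡ g = trans (cong (g ⁻¹ ∙_) (sym (⟦ι⟧ g))) (trans (⟦⟧-· (inv (ι g)) (ι g)) (inv-·ˡ (ι g)))

  ∙-inverseʳ : ∀ g → g ∙ g ⁻¹ ≡ ε
  ∙-inverseʳ g = trans (cong (_∙ g ⁻¹) (sym (⟦ι⟧ g))) (trans (⟦⟧-· (ι g) (inv (ι g))) (inv-·ʳ (ι g)))

  isGroup : IsGroup _≡_ _∙_ ε _⁻¹
  isGroup = record
    { isMonoid = record
      { isSemigroup = record
        { isMagma = record { isEquivalence = isEquivalence ; ∙-cong = cong₂ _∙_ }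
        ; assoc   = ∙-assoc
        }
      ; identity = ∙-identityˡ , ∙-identityʳ
      }
    ; inverse = ∙-inverseˡ , ∙-inverseʳ
    ; ⁻¹-cong = cong _⁻¹
    }

  open Cayley isGroup ⟦ 0 , 1 ⟧ ⟦ 1 , 0 ⟧ public
  open GroupProperties group using (inverseʳ-unique)

  genℕ : Letter → ℕ × ℕ
  genℕ ρ  = 0 , 1
  genℕ ρ⁻ = 0 , M-1
  genℕ λ′ = 1 , 0
  genℕ λ⁻ = K-1 , 0

  evalℕ : Word → ℕ × ℕ
  evalℕ []      = 0 , 0
  evalℕ (x ∷ w) = genℕ x · evalℕ w

  evalℕ-++ : ∀ u v → evalℕ (u ++ v) ≡ evalℕ u · evalℕ v
  evalℕ-++ []      v = sym (·-identityˡ (evalℕ v))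
  evalℕ-++ (x ∷ u) v = trans (cong (genℕ x ·_) (evalℕ-++ u v)) (sym (·-assoc (genℕ x) (evalℕ u) (evalℕ v)))

  gen≡⟦genℕ⟧ : ∀ x → gen x ≡ ⟦ genℕ x ⟧
  gen≡⟦genℕ⟧ ρ  = refl
  gen≡⟦genℕ⟧ ρ⁻ = sym (inverseʳ-unique ⟦ 0 , 1 ⟧ ⟦ 0 , M-1 ⟧
    (trans (⟦⟧-· (0 , 1) (0 , M-1)) (⟦⟧-cong (≡⇒≡mod (*-zeroʳ (r * 1))) d≡0-mod)))
  gen≡⟦genℕ⟧ λ′ = refl
  gen≡⟦genℕ⟧ λ⁻ = sym (inverseʳ-unique ⟦ 1 , 0 ⟧ ⟦ K-1 , 0 ⟧
    (trans (⟦⟧-· (1 , 0) (K-1 , 0))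
           (⟦⟧-cong (subst (_≡ 0 mod K) (cong suc (sym (+-identityʳ K-1))) d≡0-mod) (≡mod-refl {a = 0}))))

  eval≡⟦evalℕ⟧ : ∀ w → eval w ≡ ⟦ evalℕ w ⟧
  eval≡⟦evalℕ⟧ []      = refl
  eval≡⟦evalℕ⟧ (x ∷ w) = trans (cong₂ _∙_ (gen≡⟦genℕ⟧ x) (eval≡⟦evalℕ⟧ w)) (⟦⟧-· (genℕ x) (evalℕ w))

  ·-translationˡ : ∀ c c′ j → (c , 0) · (c′ , j) ≡ (c + c′ , j)
  ·-translationˡ c c′ j = cong (λ e → c + e , j) (*-identityˡ c′)

  evalℕ-translation^ : ∀ x {c} → genℕ x ≡ (c , 0) → ∀ t → evalℕ ((x ∷ []) ^ʷ t) ≡ (t * c , 0)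
  evalℕ-translation^ x     eq zero    = refl
  evalℕ-translation^ x {c} eq (suc t) = begin
    genℕ x · evalℕ ((x ∷ []) ^ʷ t)   ≡⟨ cong₂ _·_ eq (evalℕ-translation^ x eq t) ⟩
    (c , 0) · (t * c , 0)            ≡⟨ ·-translationˡ c (t * c) 0 ⟩
    (suc t * c , 0)                  ∎
    where open ≡-Reasoning

  eval-translation^ : ∀ u {c} → eval u ≡ ⟦ c , 0 ⟧ → ∀ t → eval (u ^ʷ t) ≡ ⟦ t * c , 0 ⟧
  eval-translation^ u     eq zero    = refl
  eval-translation^ u {c} eq (suc t) = begin
    eval (u ++ u ^ʷ t)                ≡⟨ eval-++ u (u ^ʷ t) ⟩
    eval u ∙ eval (u ^ʷ t)            ≡⟨ cong₂ _∙_ eq (eval-translation^ u eq t) ⟩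
    ⟦ c , 0 ⟧ ∙ ⟦ t * c , 0 ⟧         ≡⟨ ⟦⟧-· (c , 0) (t * c , 0) ⟩
    ⟦ (c , 0) · (t * c , 0) ⟧         ≡⟨ cong ⟦_⟧ (·-translationˡ c (t * c) 0) ⟩
    ⟦ suc t * c , 0 ⟧                 ∎
    where open ≡-Reasoning

  evalℕ-ρ^ : ∀ t → evalℕ ((ρ ∷ []) ^ʷ t) ≡ (0 , t)
  evalℕ-ρ^ zero    = refl
  evalℕ-ρ^ (suc t) = trans (cong ((0 , 1) ·_) (evalℕ-ρ^ t)) (cong (_, suc t) (*-zeroʳ (r * 1)))

  λᶜρʲ : ℕ → ℕ → Word
  λᶜρʲ c j = (λ′ ∷ []) ^ʷ c ++ (ρ ∷ []) ^ʷ j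

  evalℕ-λᶜρʲ : ∀ c j → evalℕ (λᶜρʲ c j) ≡ (c , j)
  evalℕ-λᶜρʲ c j = begin
    evalℕ ((λ′ ∷ []) ^ʷ c ++ (ρ ∷ []) ^ʷ j)               ≡⟨ evalℕ-++ ((λ′ ∷ []) ^ʷ c) ((ρ ∷ []) ^ʷ j) ⟩
    evalℕ ((λ′ ∷ []) ^ʷ c) · evalℕ ((ρ ∷ []) ^ʷ j)         ≡⟨ cong₂ _·_ (evalℕ-translation^ λ′ refl c) (evalℕ-ρ^ j) ⟩
    (c * 1 , 0) · (0 , j)                                 ≡⟨ ·-translationˡ (c * 1) 0 j ⟩
    (c * 1 + 0 , j)                                       ≡⟨ cong (_, j) (trans (+-identityʳ (c * 1)) (*-identityʳ c)) ⟩
    (c , j)                                               ∎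
    where open ≡-Reasoning

  generates : Generates
  generates g@(c , j) = λᶜρʲ (toℕ c) (toℕ j) , (begin
    eval (λᶜρʲ (toℕ c) (toℕ j))       ≡⟨ eval≡⟦evalℕ⟧ (λᶜρʲ (toℕ c) (toℕ j)) ⟩
    ⟦ evalℕ (λᶜρʲ (toℕ c) (toℕ j)) ⟧  ≡⟨ cong ⟦_⟧ (evalℕ-λᶜρʲ (toℕ c) (toℕ j)) ⟩
    ⟦ ι g ⟧                           ≡⟨ ⟦ι⟧ g ⟩
    g                                 ∎)
    where open ≡-Reasoning

  enumeration : G ↔ Fin (suc (M-1 + K-1 * M))
  enumeration = ↔-sym *↔×

  𝓗 : Hypermap
  𝓗 = cayley enumeration

  to-ε : Inverse.to enumeration ε ≡ Fin.zero
  to-ε = refl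

  -- The chirality group

  module Chirality (n s : ℕ) .{{_ : NonZero s}} (K≡n*s : K ≡ n * s) (r²≡1+s : r ^ 2 ≡ 1 + s) where

    s∣K : s ∣ K
    s∣K = divides n K≡n*s

    r²≡1 : r ^ 2 ≡ 1 mod s
    r²≡1 = subst (_≡ 1 mod s) (sym r²≡1+s) (+-congˡ-mod 1 d≡0-mod)

    r^-opposite : ∀ j k → j + k ≡ 0 mod M → r ^ j ≡ r ^ k mod s
    r^-opposite j k j+k≡0 = begin
      r ^ j                      ≡⟨ *-identityʳ (r ^ j) ⟨
      r ^ j * 1                  ≡⟨ cong (r ^ j *_) (^-zeroˡ k) ⟨
      r ^ j * 1 ^ k              ≈⟨ *-congˡ-mod (r ^ j) (^-congˡ-mod r²≡1 k) ⟨
      r ^ j * (r ^ 2) ^ k        ≡⟨ cong (r ^ j *_) (^-*-assoc r 2 k) ⟩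
      r ^ j * r ^ (2 * k)        ≡⟨ ^-distribˡ-+-* r j (2 * k) ⟨
      r ^ (j + 2 * k)            ≡⟨ cong (r ^_) (regroup j k) ⟩
      r ^ (j + k + k)            ≡⟨ ^-distribˡ-+-* r (j + k) k ⟩
      r ^ (j + k) * r ^ k        ≈⟨ *-congʳ-mod (r ^ k) (≡mod-weaken s∣K (r^-cong j+k≡0)) ⟩
      1 * r ^ k                  ≡⟨ *-identityˡ (r ^ k) ⟩
      r ^ k                      ∎
      where
        open ≡mod-Reasoning s
        regroup : ∀ j k → j + 2 * k ≡ j + k + k
        regroup = solve-∀

    -- y represents the image of x under the automorphism (c , j) ↦ (−c , −j) of ℤ_s ⋊_r ℤ_M.
    Opposite : ℕ × ℕ → ℕ × ℕ → Set
    Opposite x y = proj₁ x + proj₁ y ≡ 0 mod s × proj₂ x + proj₂ y ≡ 0 mod M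

    Opposite-sym : ∀ x y → Opposite x y → Opposite y x
    Opposite-sym (c , j) (c′ , j′) (c+c′≡0 , j+j′≡0) =
      subst (_≡ 0 mod s) (+-comm c c′) c+c′≡0 , subst (_≡ 0 mod M) (+-comm j j′) j+j′≡0

    Opposite-· : ∀ x y x′ y′ → Opposite x x′ → Opposite y y′ → Opposite (x · y) (x′ · y′)
    Opposite-· (c , j) (d , k) (c′ , j′) (d′ , k′) (c+c′≡0 , j+j′≡0) (d+d′≡0 , k+k′≡0) = first , second
      where
        r^j′≡r^j : r ^ j′ ≡ r ^ j mod s
        r^j′≡r^j = r^-opposite j′ j (subst (_≡ 0 mod M) (+-comm j j′) j+j′≡0)

        first : c + r ^ j * d + (c′ + r ^ j′ * d′) ≡ 0 mod s
        first = begin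
          c + r ^ j * d + (c′ + r ^ j′ * d′)      ≡⟨ interchange c (r ^ j * d) c′ (r ^ j′ * d′) ⟩
          c + c′ + (r ^ j * d + r ^ j′ * d′)      ≈⟨ +-cong-mod c+c′≡0 (+-congˡ-mod (r ^ j * d) (*-congʳ-mod d′ r^j′≡r^j)) ⟩
          r ^ j * d + r ^ j * d′                  ≡⟨ *-distribˡ-+ (r ^ j) d d′ ⟨
          r ^ j * (d + d′)                        ≈⟨ *-congˡ-mod (r ^ j) d+d′≡0 ⟩
          r ^ j * 0                               ≡⟨ *-zeroʳ (r ^ j) ⟩
          0                                       ∎
          where open ≡mod-Reasoning s

        second : j + k + (j′ + k′) ≡ 0 mod M
        second = subst (_≡ 0 mod M) (sym (interchange j k j′ k′)) (+-cong-mod j+j′≡0 k+k′≡0)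

    Opposite-genℕ : ∀ x → Opposite (genℕ x) (genℕ (mirrorL x))
    Opposite-genℕ ρ  = ≡mod-refl , d≡0-mod
    Opposite-genℕ ρ⁻ = Opposite-sym (genℕ ρ) (genℕ ρ⁻) (Opposite-genℕ ρ)
    Opposite-genℕ λ′ = ≡mod-weaken s∣K d≡0-mod , ≡mod-refl
    Opposite-genℕ λ⁻ = Opposite-sym (genℕ λ′) (genℕ λ⁻) (Opposite-genℕ λ′)

    Opposite-evalℕ : ∀ w → Opposite (evalℕ w) (evalℕ (mirror w))
    Opposite-evalℕ []      = ≡mod-refl , ≡mod-refl
    Opposite-evalℕ (x ∷ w) = Opposite-· (genℕ x) (evalℕ w) (genℕ (mirrorL x)) (evalℕ (mirror w))
                                        (Opposite-genℕ x) (Opposite-evalℕ w)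

    mirror-of-relator : ∀ w → eval w ≡ ε → ∃ λ i → i < n × eval (mirror w) ≡ ⟦ i * s , 0 ⟧
    mirror-of-relator w eval-w≡ε = i , i<n , (begin
      eval (mirror w)     ≡⟨ eval≡⟦evalℕ⟧ (mirror w) ⟩
      ⟦ c′ , j′ ⟧         ≡⟨ ⟦⟧-cong c′≡i*s (+-cancelˡ-≡0-mod j≡0 j+j′≡0) ⟩
      ⟦ i * s , 0 ⟧       ∎)
      where
        open ≡-Reasoning
        c′ = proj₁ (evalℕ (mirror w))
        j′ = proj₂ (evalℕ (mirror w))
        evalℕ-w≡0 = ⟦⟧-injective (evalℕ w) (0 , 0) (trans (sym (eval≡⟦evalℕ⟧ w)) eval-w≡ε)
        c≡0 = proj₁ evalℕ-w≡0
        j≡0 = proj₂ evalℕ-w≡0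
        c+c′≡0 = proj₁ (Opposite-evalℕ w)
        j+j′≡0 = proj₂ (Opposite-evalℕ w)

        c′≡0 : c′ ≡ 0 mod s
        c′≡0 = +-cancelˡ-≡0-mod (≡mod-weaken s∣K c≡0) c+c′≡0

        i : ℕ
        i = c′ % K / s

        c′%K≡i*s : c′ % K ≡ i * s
        c′%K≡i*s = begin
          c′ % K                      ≡⟨ m≡m%n+[m/n]*n (c′ % K) s ⟩
          c′ % K % s + i * s          ≡⟨ cong (_+ i * s) (trans (m∣n⇒o%n%m≡o%m s K c′ s∣K) (trans (%-≡ c′≡0) 0%d≡0)) ⟩
          i * s                       ∎

        c′≡i*s : c′ ≡ i * s mod K
        c′≡i*s = ≡mod-trans (≡mod-sym (%-≡mod c′)) (≡⇒≡mod c′%K≡i*s)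

        i<n : i < n
        i<n = m<n*o⇒m/o<n (subst (c′ % K <_) K≡n*s (m%n<n c′ K))

    translations-distinct : ∀ i j → i < n → j < n → ⟦ i * s , 0 ⟧ ≡ ⟦ j * s , 0 ⟧ → i ≡ j
    translations-distinct i j i<n j<n eq =
      *-cancelʳ-≡ i j s (≡mod⇒≡ (*s<K i<n) (*s<K j<n) (proj₁ (⟦⟧-injective (i * s , 0) (j * s , 0) eq)))
      where
        *s<K : ∀ {i} → i < n → i * s < K
        *s<K {i} i<n = subst (i * s <_) (sym K≡n*s) (*-monoˡ-< s i<n)

    w₀ : Word
    w₀ = ρ⁻ ∷ (λ⁻ ∷ []) ^ʷ r ++ ρ ∷ λ′ ∷ []

    evalℕ-w₀ : evalℕ w₀ ≡ (0 , M-1) · (r * K-1 + r ^ 1 * 1 , 1)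
    evalℕ-w₀ = begin
      evalℕ w₀                                         ≡⟨⟩
      (0 , M-1) · evalℕ (λ⁻ʳ ++ ρλ)                    ≡⟨ cong ((0 , M-1) ·_) (evalℕ-++ λ⁻ʳ ρλ) ⟩
      (0 , M-1) · (evalℕ λ⁻ʳ · evalℕ ρλ)               ≡⟨ cong (λ x → (0 , M-1) · (x · evalℕ ρλ)) (evalℕ-translation^ λ⁻ refl r) ⟩
      (0 , M-1) · ((r * K-1 , 0) · (r ^ 1 * 1 , 1))    ≡⟨ cong ((0 , M-1) ·_) (·-translationˡ (r * K-1) (r ^ 1 * 1) 1) ⟩
      (0 , M-1) · (r * K-1 + r ^ 1 * 1 , 1)            ∎
      where
        open ≡-Reasoning
        λ⁻ʳ = (λ⁻ ∷ []) ^ʷ r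
        ρλ  = ρ ∷ λ′ ∷ []

    eval-w₀ : eval w₀ ≡ ε
    eval-w₀ = trans (eval≡⟦evalℕ⟧ w₀) (trans (cong ⟦_⟧ evalℕ-w₀)
      (⟦⟧-cong first (subst (_≡ 0 mod M) (+-comm 1 M-1) d≡0-mod)))
      where
        factor : ∀ a b k → (1 + k) * (a * b) ≡ a * (b * k + b * 1 * 1)
        factor = solve-∀
        first : r ^ M-1 * (r * K-1 + r ^ 1 * 1) ≡ 0 mod K
        first = subst (_≡ 0 mod K) (factor (r ^ M-1) r K-1) (d*m≡0-mod (r ^ M-1 * r))

    mirror-w₀ : mirror w₀ ≡ ρ ∷ (λ′ ∷ []) ^ʷ r ++ ρ⁻ ∷ λ⁻ ∷ []
    mirror-w₀ = cong (ρ ∷_) (trans (map-++ mirrorL ((λ⁻ ∷ []) ^ʷ r) (ρ ∷ λ′ ∷ []))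
                                   (cong (_++ ρ⁻ ∷ λ⁻ ∷ []) (mirror-^ʷ (λ⁻ ∷ []) r)))

    evalℕ-mirror-w₀ : evalℕ (mirror w₀) ≡ (0 , 1) · (r * 1 + r ^ M-1 * K-1 , M-1 + 0)
    evalℕ-mirror-w₀ = begin
      evalℕ (mirror w₀)                                        ≡⟨ cong evalℕ mirror-w₀ ⟩
      (0 , 1) · evalℕ (λʳ ++ ρ⁻λ⁻)                              ≡⟨ cong ((0 , 1) ·_) (evalℕ-++ λʳ ρ⁻λ⁻) ⟩
      (0 , 1) · (evalℕ λʳ · evalℕ ρ⁻λ⁻)                         ≡⟨ cong₂ (λ x y → (0 , 1) · (x · ((0 , M-1) · y)))
                                                                        (evalℕ-translation^ λ′ refl r) (·-identityʳ (K-1 , 0)) ⟩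
      (0 , 1) · ((r * 1 , 0) · (r ^ M-1 * K-1 , M-1 + 0))      ≡⟨ cong ((0 , 1) ·_) (·-translationˡ (r * 1) (r ^ M-1 * K-1) (M-1 + 0)) ⟩
      (0 , 1) · (r * 1 + r ^ M-1 * K-1 , M-1 + 0)              ∎
      where
        open ≡-Reasoning
        λʳ    = (λ′ ∷ []) ^ʷ r
        ρ⁻λ⁻  = ρ⁻ ∷ λ⁻ ∷ []

    r[r+r^M-1*K-1]≡s : r ^ 1 * (r * 1 + r ^ M-1 * K-1) ≡ s mod K
    r[r+r^M-1*K-1]≡s = begin
      r ^ 1 * (r * 1 + r ^ M-1 * K-1)      ≡⟨ expand r (r ^ M-1) K-1 ⟩
      r ^ 2 + r ^ M * K-1                  ≈⟨ +-cong-mod (≡⇒≡mod r²≡1+s) (*-congʳ-mod K-1 r^M≡1) ⟩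
      1 + s + 1 * K-1                      ≡⟨ regroup s K-1 ⟩
      s + K                                ≈⟨ +-congˡ-mod s d≡0-mod ⟩
      s + 0                                ≡⟨ +-identityʳ s ⟩
      s                                    ∎
      where
        open ≡mod-Reasoning K
        expand : ∀ a b k → a * 1 * (a * 1 + b * k) ≡ a * (a * 1) + a * b * k
        expand = solve-∀
        regroup : ∀ s k → 1 + s + 1 * k ≡ s + (1 + k)
        regroup = solve-∀

    eval-mirror-w₀ : eval (mirror w₀) ≡ ⟦ s , 0 ⟧
    eval-mirror-w₀ = trans (eval≡⟦evalℕ⟧ (mirror w₀)) (trans (cong ⟦_⟧ evalℕ-mirror-w₀)
      (⟦⟧-cong r[r+r^M-1*K-1]≡s (subst (_≡ 0 mod M) (cong suc (sym (+-identityʳ M-1))) d≡0-mod)))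

    eval-mirror-w₀^ : ∀ i → eval (mirror w₀ ^ʷ i) ≡ ⟦ i * s , 0 ⟧
    eval-mirror-w₀^ = eval-translation^ (mirror w₀) eval-mirror-w₀

    chirality : ChiralityCyclicOfOrder 𝓗 n
    chirality = chirality-cyclic enumeration to-ε n w₀ eval-w₀ covered distinct
      where
        covered : ∀ w → eval w ≡ ε → ∃ λ i → i < n × eval (mirror w) ≡ eval (mirror w₀ ^ʷ i)
        covered w eval-w≡ε with mirror-of-relator w eval-w≡ε
        ... | i , i<n , eq = i , i<n , trans eq (sym (eval-mirror-w₀^ i))
        distinct : ∀ i j → i < n → j < n → eval (mirror w₀ ^ʷ i) ≡ eval (mirror w₀ ^ʷ j) → i ≡ j
        distinct i j i<n j<n eq =
          translations-distinct i j i<n j<n (trans (sym (eval-mirror-w₀^ i)) (trans eq (eval-mirror-w₀^ j)))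

[1+s]^t≡1+t*s : ∀ s t .{{_ : NonZero (s * s)}} → (1 + s) ^ t ≡ 1 + t * s mod s * s
[1+s]^t≡1+t*s s zero    = ≡mod-refl
[1+s]^t≡1+t*s s (suc t) = begin
  (1 + s) * (1 + s) ^ t                 ≈⟨ *-congˡ-mod (1 + s) ([1+s]^t≡1+t*s s t) ⟩
  (1 + s) * (1 + t * s)                 ≡⟨ expand s t ⟩
  1 + suc t * s + s * s * t             ≈⟨ +-congˡ-mod (1 + suc t * s) (d*m≡0-mod t) ⟩
  1 + suc t * s + 0                     ≡⟨ +-identityʳ (1 + suc t * s) ⟩
  1 + suc t * s                         ∎
  where
    open ≡mod-Reasoning (s * s)
    expand : ∀ s t → (1 + s) * (1 + t * s) ≡ 1 + (1 + t) * s + s * s * t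
    expand = solve-∀

module Parameters (n-1 : ℕ) where

  n s : ℕ
  n = suc n-1
  s = n * (n + 2)

  [1+n]²≡1+s : suc n ^ 2 ≡ 1 + s
  [1+n]²≡1+s = square n
    where
      square : ∀ n → suc n * (suc n * 1) ≡ 1 + n * (n + 2)
      square = solve-∀

  [1+n]^2n≡1 : suc n ^ (n + n) ≡ 1 mod n * s
  [1+n]^2n≡1 = begin
    suc n ^ (n + n)           ≡⟨ cong (suc n ^_) (double n) ⟩
    suc n ^ (2 * n)           ≡⟨ ^-*-assoc (suc n) 2 n ⟨
    (suc n ^ 2) ^ n           ≡⟨ cong (_^ n) [1+n]²≡1+s ⟩
    (1 + s) ^ n               ≈⟨ ≡mod-weaken (divides (n + 2) (square-factor n)) ([1+s]^t≡1+t*s s n) ⟩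
    1 + n * s                 ≈⟨ +-congˡ-mod 1 d≡0-mod ⟩
    1                         ∎
    where
      open ≡mod-Reasoning (n * s)
      double : ∀ n → n + n ≡ 2 * n
      double = solve-∀
      square-factor : ∀ n → n * (n + 2) * (n * (n + 2)) ≡ (n + 2) * (n * (n * (n + 2)))
      square-factor = solve-∀

proposition19 : (n : ℕ) → n ≥ 1 →
    Σ Hypermap (λ 𝓗 → Transitive 𝓗 × OrientablyRegular 𝓗 × ChiralityCyclicOfOrder 𝓗 n)
proposition19 (suc n-1) _ =
  𝓗 , transitive enumeration generates , orientablyRegular enumeration generates , chirality
  where
    open Parameters n-1
    open Semidirect (pred (n * s)) (pred (n + n)) (suc n) [1+n]^2n≡1
    open Chirality n s refl [1+n]²≡1+s
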